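{- Let $\ell,n,\Delta\in\mathbb{N}^+$, $\mu=\Delta/\ell$, $\nu=\max\{\lfloor\mu\rfloor,1\}$ and $s=\lfloor n/\nu\rfloor$. For $x=(x_1,\dots,x_n)\in\{0,1,\dots,\ell\}^n$ define integers $y_1,\dots,y_s$ iteratively by $$y_k=\Big\lfloor \Delta^{ -1}\sum_{d=n-\nu k+1}^{n}x_d\Big\rfloor-\sum_{j=1}^{k-1}y_j\qquad(k=1,\dots,s),$$ and let $\mathfrak r=\sum_{d=1}^n x_d-\Delta\sum_{j=1}^s y_j$. Then $\mathfrak r<2\Delta$. -}

module Defs where

open import Data.Nat using (ℕ; zero; suc; _+_; _*_; _∸_; _≤_; _≤?_; _⊔_; _/_; NonZero; >-nonZero)
open import Data.Nat.Properties using (m≤n⊔m)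
open import Data.Fin using (Fin; toℕ)
open import Data.Integer as ℤ using (ℤ; +_)
open import Relation.Nullary.Decidable using (does)
open import Data.Bool using (if_then_else_)

finSum : ∀ {n} → (Fin n → ℕ) → ℕ
finSum {zero} f = 0
finSum {suc n} f = f Fin.zero + finSum (λ i → f (Fin.suc i))
  where import Data.Fin as Fin

-- x = (x_1,…,x_n) is represented as x : Fin n → ℕ with x_d = x (d-1).
-- tailSum x m = Σ_{d = n-m+1}^{n} x_d  (0-based: indices i with n ∸ m ≤ i)
tailSum : ∀ {n} → (Fin n → ℕ) → ℕ → ℕ
tailSum {n} x m = finSum (λ i → if does (n ∸ m ≤? toℕ i) then x i else 0)

ν : (ℓ Δ : ℕ) → .{{NonZero ℓ}} → ℕ
ν ℓ Δ = (Δ / ℓ) ⊔ 1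

ν-nonZero : (ℓ Δ : ℕ) → .{{_ : NonZero ℓ}} → NonZero (ν ℓ Δ)
ν-nonZero ℓ Δ = >-nonZero (m≤n⊔m (Δ / ℓ) 1)

s : (ℓ n Δ : ℕ) → .{{NonZero ℓ}} → ℕ
s ℓ n Δ = _/_ n (ν ℓ Δ) {{ν-nonZero ℓ Δ}}

module _ (ℓ n Δ : ℕ) .{{_ : NonZero ℓ}} .{{_ : NonZero Δ}} (x : Fin n → ℕ) where
  F : ℕ → ℕ
  F k = tailSum x (ν ℓ Δ * k) / Δ

  mutual
    -- y k  for k ≥ 1  (y 0 is unused, set to 0)
    y : ℕ → ℤ
    y zero = + 0
    y (suc k) = + F (suc k) ℤ.- ySum k

    ySum : ℕ → ℤ
    ySum zero = + 0
    ySum (suc k) = ySum k ℤ.+ y (suc k)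

  𝔯 : ℤ
  𝔯 = + finSum x ℤ.- (+ Δ) ℤ.* ySum (s ℓ n Δ)

-- The y_k telescope: y_1 + ⋯ + y_s = ⌊T/Δ⌋, where T is the sum of the last νs
-- coordinates.  Hence 𝔯 = (T mod Δ) + H, where H is the sum of the first n − νs =
-- n mod ν coordinates.  The first summand is below Δ, and H ≤ (n mod ν)ℓ ≤ (ν − 1)ℓ
-- ≤ ⌊Δ/ℓ⌋ℓ ≤ Δ because every coordinate is at most ℓ.
module Submission where

open import Defs
open import Data.Nat using (ℕ; _≤_; _*_; NonZero)
open import Data.Fin using (Fin)
open import Data.Integer using (+_; _<_)

open import Data.Bool using (Bool; true; false; if_then_else_)
open import Data.Fin as Fin using (toℕ)
open import Data.Fin.Properties using (toℕ<n)
open import Data.Integer as ℤ using (_-_; +<+)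
import Data.Integer.Properties as ℤ
open import Data.Nat as ℕ using (zero; suc; _+_; _∸_; _/_; _%_; _≤?_)
import Data.Nat.Properties as ℕ
open import Data.Nat.DivMod using (m≡m%n+[m/n]*n; m%n≡m∸m/n*n; m%n<n; m/n*n≤m; 0/n≡0)
open import Algebra.Properties.CommutativeSemigroup ℕ.+-commutativeSemigroup
  using (interchange; xy∙z≈xz∙y)
open import Algebra.Properties.AbelianGroup ℤ.+-0-abelianGroup using (\\-leftDividesˡ)
open import Function using (_∘_)
open import Function.Bundles using (mk⇔)
open import Relation.Nullary.Decidable using (does; does-⇔; dec-false)
open import Relation.Binary.PropositionalEquality

finSum-cong : ∀ {n} {f g : Fin n → ℕ} → (∀ i → f i ≡ g i) → finSum f ≡ finSum g
finSum-cong {zero}  f≗g = refl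
finSum-cong {suc n} f≗g = cong₂ _+_ (f≗g Fin.zero) (finSum-cong (f≗g ∘ Fin.suc))

finSum-zero : ∀ {n} (f : Fin n → ℕ) → (∀ i → f i ≡ 0) → finSum f ≡ 0
finSum-zero {zero}  f f≗0 = refl
finSum-zero {suc n} f f≗0 rewrite f≗0 Fin.zero = finSum-zero (f ∘ Fin.suc) (f≗0 ∘ Fin.suc)

finSum-+ : ∀ {n} (f g : Fin n → ℕ) → finSum (λ i → f i + g i) ≡ finSum f + finSum g
finSum-+ {zero}  f g = refl
finSum-+ {suc n} f g = begin
  f Fin.zero + g Fin.zero + finSum (λ i → f (Fin.suc i) + g (Fin.suc i))
    ≡⟨ cong (λ t → f Fin.zero + g Fin.zero + t) (finSum-+ (f ∘ Fin.suc) (g ∘ Fin.suc)) ⟩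
  f Fin.zero + g Fin.zero + (finSum (f ∘ Fin.suc) + finSum (g ∘ Fin.suc))
    ≡⟨ interchange (f Fin.zero) (g Fin.zero) _ _ ⟩
  finSum f + finSum g ∎
  where open ≡-Reasoning

finSum-partition : ∀ {n} (b : Fin n → Bool) (f : Fin n → ℕ) →
  finSum f ≡ finSum (λ i → if b i then f i else 0) + finSum (λ i → if b i then 0 else f i)
finSum-partition b f =
  trans (finSum-cong (λ i → split (b i) (f i))) (finSum-+ (λ i → if b i then f i else 0) (λ i → if b i then 0 else f i))
  where
  split : ∀ c a → a ≡ (if c then a else 0) + (if c then 0 else a)
  split true  a = sym (ℕ.+-identityʳ a)
  split false a = refl

headSum : ∀ {n} → (Fin n → ℕ) → ℕ → ℕ
headSum x k = finSum (λ i → if does (k ≤? toℕ i) then 0 else x i)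

finSum≡tailSum+headSum : ∀ {n} (x : Fin n → ℕ) m → finSum x ≡ tailSum x m + headSum x (n ∸ m)
finSum≡tailSum+headSum {n} x m = finSum-partition (λ i → does (n ∸ m ≤? toℕ i)) x

tailSum-zero : ∀ {n} (x : Fin n → ℕ) → tailSum x 0 ≡ 0
tailSum-zero {n} x = finSum-zero _ (λ i → cong (λ c → if c then x i else 0) (n≰i i))
  where
  n≰i : (i : Fin n) → does (n ≤? toℕ i) ≡ false
  n≰i i = dec-false (n ≤? toℕ i) (ℕ.<⇒≱ (toℕ<n i))

headSum-≤ : ∀ {n ℓ} (x : Fin n → ℕ) → (∀ i → x i ≤ ℓ) → ∀ k → headSum x k ≤ k * ℓ
headSum-≤ {zero}  x x≤ℓ k       = ℕ.z≤n
headSum-≤ {suc n} x x≤ℓ zero    = headSum-≤ (x ∘ Fin.suc) (x≤ℓ ∘ Fin.suc) zero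
headSum-≤ {suc n} x x≤ℓ (suc k) = ℕ.+-mono-≤ (x≤ℓ Fin.zero) (begin
  finSum (λ i → if does (suc k ≤? suc (toℕ i)) then 0 else x (Fin.suc i))
    ≡⟨ finSum-cong (λ i → cong (λ c → if c then 0 else x (Fin.suc i)) (does-suc k (toℕ i))) ⟩
  headSum (x ∘ Fin.suc) k
    ≤⟨ headSum-≤ (x ∘ Fin.suc) (x≤ℓ ∘ Fin.suc) k ⟩
  k * _ ∎)
  where
  open ℕ.≤-Reasoning
  does-suc : ∀ a b → does (suc a ≤? suc b) ≡ does (a ≤? b)
  does-suc a b = does-⇔ (mk⇔ ℕ.≤-pred ℕ.s≤s) (suc a ≤? suc b) (a ≤? b)

+[m+n]-+n≡+m : ∀ m n → + (m + n) - + n ≡ + m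
+[m+n]-+n≡+m m n = begin
  + (m + n) - + n ≡⟨ ℤ.m-n≡m⊖n (m + n) n ⟩
  (m + n) ℤ.⊖ n   ≡⟨ ℤ.⊖-≥ (ℕ.m≤n+m n m) ⟩
  + (m + n ∸ n)   ≡⟨ cong +_ (ℕ.m+n∸n≡m m n) ⟩
  + m             ∎
  where open ≡-Reasoning

i+[j-i]≡j : ∀ i j → i ℤ.+ (j - i) ≡ j
i+[j-i]≡j i j = trans (cong (λ t → i ℤ.+ t) (ℤ.+-comm j (ℤ.- i))) (\\-leftDividesˡ i j)

module _ (ℓ n Δ : ℕ) .{{_ : NonZero ℓ}} .{{_ : NonZero Δ}} (x : Fin n → ℕ) where

  private instance
    ν≢0 : NonZero (ν ℓ Δ)
    ν≢0 = ν-nonZero ℓ Δ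

  ySum≡F : ∀ k → ySum ℓ n Δ x k ≡ + F ℓ n Δ x k
  ySum≡F zero rewrite ℕ.*-zeroʳ (ν ℓ Δ) | tailSum-zero x = cong +_ (sym (0/n≡0 Δ))
  ySum≡F (suc k) = i+[j-i]≡j (ySum ℓ n Δ x k) (+ F ℓ n Δ x (suc k))

  𝔯≡remainder+headSum :
    𝔯 ℓ n Δ x ≡ + (tailSum x (ν ℓ Δ * s ℓ n Δ) % Δ + headSum x (n % ν ℓ Δ))
  𝔯≡remainder+headSum = begin
    + S - + Δ ℤ.* ySum ℓ n Δ x (s ℓ n Δ)  ≡⟨ cong (λ t → + S - + Δ ℤ.* t) (ySum≡F (s ℓ n Δ)) ⟩
    + S - + Δ ℤ.* + (T / Δ)               ≡⟨ cong (+ S -_) (ℤ.pos-* Δ (T / Δ)) ⟨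
    + S - + (Δ * (T / Δ))                 ≡⟨ cong (λ t → + t - + (Δ * (T / Δ))) S≡r+Δq ⟩
    + (r + Δ * (T / Δ)) - + (Δ * (T / Δ)) ≡⟨ +[m+n]-+n≡+m r (Δ * (T / Δ)) ⟩
    + r                                   ∎
    where
    open ≡-Reasoning
    S = finSum x
    T = tailSum x (ν ℓ Δ * s ℓ n Δ)
    r = T % Δ + headSum x (n % ν ℓ Δ)

    n∸νs≡n%ν : n ∸ ν ℓ Δ * s ℓ n Δ ≡ n % ν ℓ Δ
    n∸νs≡n%ν = trans (cong (n ∸_) (ℕ.*-comm (ν ℓ Δ) (s ℓ n Δ))) (sym (m%n≡m∸m/n*n n (ν ℓ Δ)))

    S≡r+Δq : S ≡ r + Δ * (T / Δ)
    S≡r+Δq = begin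
      S
        ≡⟨ finSum≡tailSum+headSum x (ν ℓ Δ * s ℓ n Δ) ⟩
      T + headSum x (n ∸ ν ℓ Δ * s ℓ n Δ)
        ≡⟨ cong₂ (λ a b → a + headSum x b) (m≡m%n+[m/n]*n T Δ) n∸νs≡n%ν ⟩
      T % Δ + (T / Δ) * Δ + headSum x (n % ν ℓ Δ)
        ≡⟨ xy∙z≈xz∙y (T % Δ) _ _ ⟩
      r + (T / Δ) * Δ
        ≡⟨ cong (λ t → r + t) (ℕ.*-comm (T / Δ) Δ) ⟩
      r + Δ * (T / Δ) ∎

  headSum[n%ν]≤Δ : (∀ d → x d ≤ ℓ) → headSum x (n % ν ℓ Δ) ≤ Δ
  headSum[n%ν]≤Δ x≤ℓ = begin
    headSum x (n % ν ℓ Δ) ≤⟨ headSum-≤ x x≤ℓ (n % ν ℓ Δ) ⟩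
    n % ν ℓ Δ * ℓ         ≤⟨ ℕ.*-monoˡ-≤ ℓ n%ν≤Δ/ℓ ⟩
    Δ / ℓ * ℓ             ≤⟨ m/n*n≤m Δ ℓ ⟩
    Δ                     ∎
    where
    open ℕ.≤-Reasoning
    n%ν≤Δ/ℓ : n % ν ℓ Δ ≤ Δ / ℓ
    n%ν≤Δ/ℓ = ℕ.≤-pred (ℕ.≤-trans (m%n<n n (ν ℓ Δ)) (ℕ.⊔-lub (ℕ.n≤1+n (Δ / ℓ)) (ℕ.s≤s ℕ.z≤n)))

lemma3 : (ℓ n Δ : ℕ) → .{{_ : NonZero ℓ}} → .{{_ : NonZero n}} → .{{_ : NonZero Δ}} →
         (x : Fin n → ℕ) → (∀ d → x d ≤ ℓ) →
         𝔯 ℓ n Δ x < + (2 * Δ)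
lemma3 ℓ n Δ x x≤ℓ = subst (_< + (2 * Δ)) (sym (𝔯≡remainder+headSum ℓ n Δ x))
  -- 2 * Δ unfolds to Δ + (Δ + 0)
  (+<+ (ℕ.+-mono-<-≤ (m%n<n _ Δ) (ℕ.≤-trans (headSum[n%ν]≤Δ ℓ n Δ x x≤ℓ) (ℕ.m≤m+n Δ 0))))
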